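{- The polygon $H^{\infty}_{[0,d],u}$ is the function on $[0,+\infty)$ with value $0$ at $0$, linear on each interval $[l,l+1]$ ($l\in\mathbb N$), whose slope on $[l,l+1]$ equals $$\frac{u_0+u_1+\cdots+u_{b-1}}{bd(p-1)}+\frac{l}{d}.$$
   Context: Let $p$ be a prime, $q=p^a$, $d\ge1$, and $0\le u\le q-2$ an integer with $p$-adic digits $u=\sum_{j=0}^{a-1}u_jp^j$, $0\le u_j\le p-1$. Let $b$ be the least positive integer with $p^bu\equiv u\pmod{q-1}$. For an integer residue class $u'$ mod $q-1$ let $C_{u'}=[0,\infty)\cap(u'+(q-1)\mathbb Z)$, $M_{u'}=\frac{1}{q-1}C_{u'}$, and $\deg(v)=v/d$. List the elements of $\bigcup_{i=0}^{b-1}M_{p^iu}$ as $x_1,x_2,\dots$ with $\deg(x_1)\le\deg(x_2)\le\cdots$. $H^{\infty}_{[0,d],u}$ is defined as the function on $[0,+\infty)$ with value $0$ at $0$, linear on each $[k,k+1]$, with slope $\frac1b(\deg(x_{bk+1})+\cdots+\deg(x_{b(k+1)}))$ on $[k,k+1]$. $\mathbb N=\{0,1,2,\dots\}$. -}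

module Defs where

open import Data.Nat as ℕ using (ℕ; zero; suc; _+_; _*_; _∸_; _^_; _≤_; _<_)
open import Data.Nat.DivMod using (_/_; _%_)
open import Data.Integer as ℤ using (ℤ; +_)
open import Data.Integer.Divisibility using () renaming (_∣_ to _∣ℤ_)
open import Data.Rational as ℚ using (ℚ)
open import Data.Product using (Σ; ∃; _×_)
open import Relation.Binary.PropositionalEquality using (_≡_)
open import Relation.Nullary using (¬_)
open import Function.Definitions using (Injective)

ModEq : ℕ → ℤ → ℤ → Set
ModEq m x y = (+ m) ∣ℤ (x ℤ.- y)

-- the rational n / m ; (junk value 0 when m = 0, never used with m = 0 below)
frac : ℕ → ℕ → ℚ
frac n zero = ℚ.0ℚ
frac n (suc m) = (+ n) ℚ./ suc m

-- j-th p-adic digit of u (junk 0 if p = 0)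
digit : ℕ → ℕ → ℕ → ℕ
digit zero u j = 0
digit (suc p) u zero = u % suc p
digit (suc p) u (suc j) = digit (suc p) (u / suc p) j

sumℕ : ℕ → (ℕ → ℕ) → ℕ
sumℕ zero f = 0
sumℕ (suc n) f = sumℕ n f + f n

sumℚ : ℕ → (ℕ → ℚ) → ℚ
sumℚ zero f = ℚ.0ℚ
sumℚ (suc n) f = sumℚ n f ℚ.+ f n

IsLeastPeriod : ℕ → ℕ → ℕ → ℕ → Set
IsLeastPeriod p q u b =
  (1 ≤ b) × ModEq (q ∸ 1) (+ (p ^ b * u)) (+ u)
  × (∀ b' → 1 ≤ b' → b' < b → ¬ ModEq (q ∸ 1) (+ (p ^ b' * u)) (+ u))

-- c ∈ C_{p^i u} = [0,∞) ∩ (p^i u + (q-1)ℤ)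
InC : ℕ → ℕ → ℕ → ℕ → Set
InC p q u' c = ModEq (q ∸ 1) (+ c) (+ u')

-- v ∈ ⋃_{i<b} M_{p^i u},  M_{u'} = (1/(q-1)) C_{u'}
InUnionM : ℕ → ℕ → ℕ → ℕ → ℚ → Set
InUnionM p q u b v = ∃ λ i → ∃ λ c → (i < b) × InC p q (p ^ i * u) c × (v ≡ frac c (q ∸ 1))

deg : ℕ → ℚ → ℚ
deg d v = v ℚ.* frac 1 d

-- x : ℕ → ℚ lists the elements of ⋃_{i<b} M_{p^i u} (x j is x_{j+1}),
-- each exactly once, with deg(x_1) ≤ deg(x_2) ≤ ⋯
IsOrderedListing : ℕ → ℕ → ℕ → ℕ → ℕ → (ℕ → ℚ) → Set
IsOrderedListing p q u b d x =
  (∀ j → InUnionM p q u b (x j))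
  × (∀ v → InUnionM p q u b v → ∃ λ j → x j ≡ v)
  × Injective _≡_ _≡_ x
  × (∀ j → deg d (x j) ℚ.≤ deg d (x (suc j)))

-- slope of H^∞_{[0,d],u} on [k,k+1]:  (1/b)(deg(x_{bk+1}) + ⋯ + deg(x_{b(k+1)}))
slopeH : ℕ → ℕ → (ℕ → ℚ) → ℕ → ℚ
slopeH b d x k = frac 1 b ℚ.* sumℚ b (λ j → deg d (x (b * k + j)))

module Submission where

-- Write Q = q - 1 and w i = p^i u mod Q for the orbit of u under multiplication by p.
-- The union of the M_{p^i u} consists of the numbers (n Q + w i) / Q, n ∈ ℕ, i < b, so
-- with numerators c_0 < c_1 < ⋯ (x_j = c_j / Q), the l-th block of b consecutive
-- numerators is lQ + w 0, …, lQ + w (b-1) in some order, with sum b l Q + Σ_{i<b} w i.  Since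
-- p^a ≡ 1 mod Q, multiplication by p rotates the a base-p digits of residues, which
-- gives (p-1) Σ_{i<b} w i = Q (u_0 + ⋯ + u_{b-1}).

open import Defs
open import Data.Nat as ℕ using (ℕ; zero; suc; _+_; _*_; _∸_; _^_; _≤_; _<_; z≤n; s≤s; s≤s⁻¹; _≟_; NonZero)
open import Data.Nat.Properties
open import Algebra.Properties.CommutativeSemigroup +-commutativeSemigroup using () renaming (interchange to +-interchange)
open import Data.Nat.DivMod
open import Data.Nat.Divisibility using (_∣_; divides; divides-refl)
open import Data.Nat.Primality using (Prime; ¬prime[0]; ¬prime[1])
open import Data.Nat.Tactic.RingSolver using (solve-∀)
import Data.Integer as ℤ
open import Data.Integer.Properties using (pos-*; pos-+; drop‿+≤+; m-n≡m⊖n; ∣m⊖n∣≡∣n⊖m∣; ∣⊖∣-≤)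
open import Data.Rational as ℚ using (ℚ; toℚᵘ) renaming (_+_ to _+ℚ_)
open import Data.Rational.Properties
  using (toℚᵘ-fromℚᵘ; fromℚᵘ-cong; fromℚᵘ-toℚᵘ; toℚᵘ-homo-+; toℚᵘ-homo-*; toℚᵘ-mono-≤)
  renaming (≤-reflexive to ≤ℚ-reflexive)
open import Data.Rational.Unnormalised as U using (mkℚᵘ; *≡*; *≤*)
import Data.Rational.Unnormalised.Properties as UP
open import Data.Product using (∃; _×_; _,_; proj₁; proj₂)
open import Data.Sum using (_⊎_; inj₁; inj₂)
open import Data.Empty using (⊥-elim)
open import Function.Bundles using (_⇔_; mk⇔; Equivalence)
open import Relation.Nullary using (Dec; yes; no)
open import Relation.Binary.Definitions using (tri<; tri≈; tri>)
open import Relation.Binary.PropositionalEquality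

frac≃ : ∀ n m → toℚᵘ (frac n (suc m)) U.≃ mkℚᵘ (ℤ.+ n) m
frac≃ n m = toℚᵘ-fromℚᵘ (mkℚᵘ (ℤ.+ n) m)

frac-from≃ : ∀ r n m → toℚᵘ r U.≃ mkℚᵘ (ℤ.+ n) m → r ≡ frac n (suc m)
frac-from≃ r n m r≃ = trans (sym (fromℚᵘ-toℚᵘ r)) (fromℚᵘ-cong r≃)

frac-cross : ∀ a m b n → a * suc n ≡ b * suc m → frac a (suc m) ≡ frac b (suc n)
frac-cross a m b n eq = frac-from≃ (frac a (suc m)) b n
  (UP.≃-trans (frac≃ a m) (*≡* (trans (sym (pos-* a (suc n))) (trans (cong ℤ.+_ eq) (pos-* b (suc m))))))

frac-+ : ∀ a m b n → frac a (suc m) ℚ.+ frac b (suc n) ≡ frac (a * suc n + b * suc m) (suc m * suc n)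
frac-+ a m b n = frac-from≃ (frac a (suc m) ℚ.+ frac b (suc n)) (a * suc n + b * suc m) (ℕ.pred (suc m * suc n))
  (UP.≃-trans (toℚᵘ-homo-+ (frac a (suc m)) (frac b (suc n)))
  (UP.≃-trans (UP.+-cong (frac≃ a m) (frac≃ b n))
           (*≡* (cong (ℤ._* (ℤ.+ (suc m * suc n))) numerator))))
  where
  numerator : ℤ.+ a ℤ.* ℤ.+ suc n ℤ.+ ℤ.+ b ℤ.* ℤ.+ suc m ≡ ℤ.+ (a * suc n + b * suc m)
  numerator = trans (cong₂ ℤ._+_ (sym (pos-* a (suc n))) (sym (pos-* b (suc m)))) (sym (pos-+ (a * suc n) (b * suc m)))

frac-* : ∀ a m b n → frac a (suc m) ℚ.* frac b (suc n) ≡ frac (a * b) (suc m * suc n)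
frac-* a m b n = frac-from≃ (frac a (suc m) ℚ.* frac b (suc n)) (a * b) (ℕ.pred (suc m * suc n))
  (UP.≃-trans (toℚᵘ-homo-* (frac a (suc m)) (frac b (suc n)))
  (UP.≃-trans (UP.*-cong (frac≃ a m) (frac≃ b n))
           (*≡* (cong (ℤ._* (ℤ.+ (suc m * suc n))) (sym (pos-* a b))))))

frac-0 : ∀ m → frac 0 (suc m) ≡ ℚ.0ℚ
frac-0 m = frac-cross 0 m 0 0 refl

frac-cancel-≤ : ∀ a b m → frac a (suc m) ℚ.≤ frac b (suc m) → a ≤ b
frac-cancel-≤ a b m le with UP.≤-respʳ-≃ (frac≃ b m) (UP.≤-respˡ-≃ (frac≃ a m) (toℚᵘ-mono-≤ le))
... | *≤* cross = *-cancelʳ-≤ a b (suc m) (drop‿+≤+ (subst₂ ℤ._≤_ (sym (pos-* a (suc m))) (sym (pos-* b (suc m))) cross))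

frac-injective : ∀ a b m → frac a (suc m) ≡ frac b (suc m) → a ≡ b
frac-injective a b m eq = ≤-antisym (frac-cancel-≤ a b m (≤ℚ-reflexive eq)) (frac-cancel-≤ b a m (≤ℚ-reflexive (sym eq)))

sumℚ-cong : ∀ n (f g : ℕ → ℚ) → (∀ i → f i ≡ g i) → sumℚ n f ≡ sumℚ n g
sumℚ-cong zero    f g f≗g = refl
sumℚ-cong (suc n) f g f≗g = cong₂ ℚ._+_ (sumℚ-cong n f g f≗g) (f≗g n)

sumℚ-frac : ∀ n M (f : ℕ → ℕ) → sumℚ n (λ j → frac (f j) (suc M)) ≡ frac (sumℕ n f) (suc M)
sumℚ-frac zero    M f = sym (frac-0 M)
sumℚ-frac (suc n) M f = begin
  sumℚ n (λ j → frac (f j) (suc M)) ℚ.+ frac (f n) (suc M) ≡⟨ cong (ℚ._+ frac (f n) (suc M)) (sumℚ-frac n M f) ⟩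
  frac s (suc M) ℚ.+ frac (f n) (suc M)                    ≡⟨ frac-+ s M (f n) M ⟩
  frac (s * suc M + f n * suc M) (suc M * suc M)           ≡⟨ frac-cross (s * suc M + f n * suc M) (ℕ.pred (suc M * suc M)) (s + f n) M (common (suc M)) ⟩
  frac (s + f n) (suc M)                                   ∎
  where
  open ≡-Reasoning
  s = sumℕ n f
  common : ∀ K → (s * K + f n * K) * K ≡ (s + f n) * (K * K)
  common K = trans (cong (_* K) (sym (*-distribʳ-+ K s (f n)))) (*-assoc (s + f n) K K)

∣x-y∣≡y∸x : ∀ {x y} → x ≤ y → ℤ.∣ ℤ.+ x ℤ.- ℤ.+ y ∣ ≡ y ∸ x
∣x-y∣≡y∸x {x} {y} x≤y = trans (cong ℤ.∣_∣ (m-n≡m⊖n x y)) (∣⊖∣-≤ x≤y)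

∣x-y∣≡x∸y : ∀ {x y} → y ≤ x → ℤ.∣ ℤ.+ x ℤ.- ℤ.+ y ∣ ≡ x ∸ y
∣x-y∣≡x∸y {x} {y} y≤x = trans (cong ℤ.∣_∣ (m-n≡m⊖n x y)) (trans (∣m⊖n∣≡∣n⊖m∣ x y) (∣⊖∣-≤ y≤x))

∣∸⇔%≡ : ∀ Q .{{_ : NonZero Q}} {x y} → x ≤ y → Q ∣ (y ∸ x) ⇔ (x % Q ≡ y % Q)
∣∸⇔%≡ Q {x} {y} x≤y = mk⇔ to from
  where
  to : Q ∣ (y ∸ x) → x % Q ≡ y % Q
  to Q∣y∸x = sym (trans (cong (_% Q) (sym (m+[n∸m]≡n x≤y))) (%-remove-+ʳ x Q∣y∸x))

  from : x % Q ≡ y % Q → Q ∣ (y ∸ x)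
  from eq = divides (y / Q ∸ x / Q) (begin
    y ∸ x                                     ≡⟨ cong₂ _∸_ (m≡m%n+[m/n]*n y Q) (m≡m%n+[m/n]*n x Q) ⟩
    (y % Q + y / Q * Q) ∸ (x % Q + x / Q * Q) ≡⟨ cong (λ r → (y % Q + y / Q * Q) ∸ (r + x / Q * Q)) eq ⟩
    (y % Q + y / Q * Q) ∸ (y % Q + x / Q * Q) ≡⟨ [m+n]∸[m+o]≡n∸o (y % Q) _ _ ⟩
    y / Q * Q ∸ x / Q * Q                     ≡⟨ *-distribʳ-∸ Q (y / Q) (x / Q) ⟨
    (y / Q ∸ x / Q) * Q                       ∎)
    where open ≡-Reasoning

modEq⇔%≡ : ∀ Q .{{_ : NonZero Q}} x y → ModEq Q (ℤ.+ x) (ℤ.+ y) ⇔ (x % Q ≡ y % Q)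
modEq⇔%≡ Q x y with ≤-total x y
... | inj₁ x≤y = mk⇔
  (λ h → Equivalence.to (∣∸⇔%≡ Q x≤y) (subst (Q ∣_) (∣x-y∣≡y∸x x≤y) h))
  (λ e → subst (Q ∣_) (sym (∣x-y∣≡y∸x x≤y)) (Equivalence.from (∣∸⇔%≡ Q x≤y) e))
... | inj₂ y≤x = mk⇔
  (λ h → sym (Equivalence.to (∣∸⇔%≡ Q y≤x) (subst (Q ∣_) (∣x-y∣≡x∸y y≤x) h)))
  (λ e → subst (Q ∣_) (sym (∣x-y∣≡x∸y y≤x)) (Equivalence.from (∣∸⇔%≡ Q y≤x) (sym e)))

sum-ext : ∀ n (f g : ℕ → ℕ) → (∀ i → i < n → f i ≡ g i) → sumℕ n f ≡ sumℕ n g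
sum-ext zero    f g f≗g = refl
sum-ext (suc n) f g f≗g = cong₂ _+_ (sum-ext n f g (λ i i<n → f≗g i (m≤n⇒m≤1+n i<n))) (f≗g n ≤-refl)

sum-+ : ∀ n (f g : ℕ → ℕ) → sumℕ n (λ i → f i + g i) ≡ sumℕ n f + sumℕ n g
sum-+ zero    f g = refl
sum-+ (suc n) f g = trans (cong (_+ (f n + g n)) (sum-+ n f g)) (+-interchange (sumℕ n f) (sumℕ n g) (f n) (g n))

sum-* : ∀ n k (f : ℕ → ℕ) → sumℕ n (λ i → k * f i) ≡ k * sumℕ n f
sum-* zero    k f = sym (*-zeroʳ k)
sum-* (suc n) k f = trans (cong (_+ k * f n) (sum-* n k f)) (sym (*-distribˡ-+ k (sumℕ n f) (f n)))

sum-const : ∀ n k → sumℕ n (λ _ → k) ≡ n * k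
sum-const zero    k = refl
sum-const (suc n) k = trans (cong (_+ k) (sum-const n k)) (+-comm (n * k) k)

sum-split : ∀ m n (f : ℕ → ℕ) → sumℕ (m + n) f ≡ sumℕ m f + sumℕ n (λ j → f (m + j))
sum-split m zero    f = trans (cong (λ k → sumℕ k f) (+-identityʳ m)) (sym (+-identityʳ _))
sum-split m (suc n) f = begin
  sumℕ (m + suc n) f                              ≡⟨ cong (λ k → sumℕ k f) (+-suc m n) ⟩
  sumℕ (m + n) f + f (m + n)                      ≡⟨ cong (_+ f (m + n)) (sum-split m n f) ⟩
  sumℕ m f + sumℕ n (λ j → f (m + j)) + f (m + n) ≡⟨ +-assoc (sumℕ m f) _ _ ⟩
  sumℕ m f + sumℕ (suc n) (λ j → f (m + j))       ∎
  where open ≡-Reasoning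

sum-suc : ∀ n (f : ℕ → ℕ) → sumℕ (suc n) f ≡ f 0 + sumℕ n (λ i → f (suc i))
sum-suc n f = sum-split 1 n f

sum-rotate : ∀ n (f : ℕ → ℕ) → f n ≡ f 0 → sumℕ n (λ i → f (suc i)) ≡ sumℕ n f
sum-rotate n f fn≡f0 = +-cancelˡ-≡ (f 0) _ _ (begin
  f 0 + sumℕ n (λ i → f (suc i)) ≡⟨ sum-suc n f ⟨
  sumℕ n f + f n                 ≡⟨ cong (sumℕ n f +_) fn≡f0 ⟩
  sumℕ n f + f 0                 ≡⟨ +-comm (sumℕ n f) (f 0) ⟩
  f 0 + sumℕ n f                 ∎)
  where open ≡-Reasoning

sum-reverse : ∀ n (f : ℕ → ℕ) → sumℕ n (λ j → f (n ∸ suc j)) ≡ sumℕ n f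
sum-reverse zero    f = refl
sum-reverse (suc n) f = begin
  sumℕ n (λ j → f (suc n ∸ suc j)) + f (n ∸ n)
    ≡⟨ cong₂ _+_ (sum-ext n _ _ (λ j j<n → cong f (+-∸-assoc 1 j<n))) (cong f (n∸n≡0 n)) ⟩
  sumℕ n (λ j → f (suc (n ∸ suc j))) + f 0
    ≡⟨ cong (_+ f 0) (sum-reverse n (λ i → f (suc i))) ⟩
  sumℕ n (λ i → f (suc i)) + f 0
    ≡⟨ +-comm _ (f 0) ⟩
  f 0 + sumℕ n (λ i → f (suc i))
    ≡⟨ sum-suc n f ⟨
  sumℕ (suc n) f ∎
  where open ≡-Reasoning

term≤sum : ∀ n (f : ℕ → ℕ) i → i < n → f i ≤ sumℕ n f
term≤sum (suc n) f i i<1+n with m≤n⇒m<n∨m≡n (s≤s⁻¹ i<1+n)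
... | inj₁ i<n  = ≤-trans (term≤sum n f i i<n) (m≤m+n _ _)
... | inj₂ refl = m≤n+m _ _

nonzero-term : ∀ n (f : ℕ → ℕ) → sumℕ n f ≢ 0 → ∃ λ i → i < n × f i ≢ 0
nonzero-term zero    f sum≢0 = ⊥-elim (sum≢0 refl)
nonzero-term (suc n) f sum≢0 with f n ≟ 0
... | no fn≢0  = n , ≤-refl , fn≢0
... | yes fn≡0 with nonzero-term n f (λ s≡0 → sum≢0 (cong₂ _+_ s≡0 fn≡0))
...   | i , i<n , fi≢0 = i , m≤n⇒m≤1+n i<n , fi≢0

δ : ℕ → ℕ → ℕ
δ s t with s ≟ t
... | yes _ = 1
... | no  _ = 0

δ-refl : ∀ t → δ t t ≡ 1
δ-refl t with t ≟ t
... | yes _   = refl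
... | no  t≢t = ⊥-elim (t≢t refl)

δ-≢ : ∀ {s t} → s ≢ t → δ s t ≡ 0
δ-≢ {s} {t} s≢t with s ≟ t
... | yes s≡t = ⊥-elim (s≢t s≡t)
... | no  _   = refl

δ≢0 : ∀ s t → δ s t ≢ 0 → s ≡ t
δ≢0 s t δ≢0 with s ≟ t
... | yes s≡t = s≡t
... | no  _   = ⊥-elim (δ≢0 refl)

sum-zero : ∀ n (f : ℕ → ℕ) → (∀ i → i < n → f i ≡ 0) → sumℕ n f ≡ 0
sum-zero n f f≡0 = trans (sum-ext n f (λ _ → 0) f≡0) (trans (sum-const n 0) (*-zeroʳ n))

sum-δ : ∀ Q s (g : ℕ → ℕ) → s < Q → sumℕ Q (λ t → δ s t * g t) ≡ g s
sum-δ (suc Q) s g s<1+Q with s ≟ Q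
... | yes refl = trans (cong (_+ (1 * g s)) (sum-zero Q _ (λ t t<s → cong (_* g t) (δ-≢ (λ s≡t → <-irrefl (sym s≡t) t<s)))))
                       (+-identityʳ (g s))
... | no  s≢Q  = trans (+-identityʳ _) (sum-δ Q s g (≤∧≢⇒< (s≤s⁻¹ s<1+Q) s≢Q))

count : ℕ → (ℕ → ℕ) → ℕ → ℕ
count n f t = sumℕ n (λ i → δ (f i) t)

sum-by-count : ∀ n Q (f g : ℕ → ℕ) → (∀ i → i < n → f i < Q) →
  sumℕ Q (λ t → count n f t * g t) ≡ sumℕ n (λ i → g (f i))
sum-by-count zero    Q f g f<Q = sum-zero Q _ (λ _ _ → refl)
sum-by-count (suc n) Q f g f<Q = begin
  sumℕ Q (λ t → (count n f t + δ (f n) t) * g t)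
    ≡⟨ sum-ext Q _ _ (λ t _ → *-distribʳ-+ (g t) (count n f t) (δ (f n) t)) ⟩
  sumℕ Q (λ t → count n f t * g t + δ (f n) t * g t)
    ≡⟨ sum-+ Q _ _ ⟩
  sumℕ Q (λ t → count n f t * g t) + sumℕ Q (λ t → δ (f n) t * g t)
    ≡⟨ cong₂ _+_ (sum-by-count n Q f g (λ i i<n → f<Q i (m≤n⇒m≤1+n i<n))) (sum-δ Q (f n) g (f<Q n ≤-refl)) ⟩
  sumℕ n (λ i → g (f i)) + g (f n) ∎
  where open ≡-Reasoning

count≤1 : ∀ n (f : ℕ → ℕ) → (∀ i j → i < n → j < n → f i ≡ f j → i ≡ j) → ∀ t → count n f t ≤ 1
count≤1 zero    f f-inj t = z≤n
count≤1 (suc n) f f-inj t = last-term (f n ≟ t)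
  where
  last-term : Dec (f n ≡ t) → count (suc n) f t ≤ 1
  last-term (yes refl) = ≤-reflexive (cong₂ _+_ earlier-miss (δ-refl (f n)))
    where
    earlier-miss : count n f (f n) ≡ 0
    earlier-miss = sum-zero n _ (λ i i<n → δ-≢ (λ fi≡fn → <-irrefl (f-inj i n (m≤n⇒m≤1+n i<n) ≤-refl fi≡fn) i<n))
  last-term (no fn≢t) = ≤-trans (≤-reflexive (trans (cong (count n f t +_) (δ-≢ fn≢t)) (+-identityʳ _)))
                                (count≤1 n f (λ i j i<n j<n → f-inj i j (m≤n⇒m≤1+n i<n) (m≤n⇒m≤1+n j<n)) t)

count-hit : ∀ n (f : ℕ → ℕ) i → i < n → 1 ≤ count n f (f i)
count-hit n f i i<n = subst (_≤ count n f (f i)) (δ-refl (f i)) (term≤sum n (λ j → δ (f j) (f i)) i i<n)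

count-preimage : ∀ n (f : ℕ → ℕ) t → count n f t ≢ 0 → ∃ λ i → i < n × f i ≡ t
count-preimage n f t count≢0 with nonzero-term n (λ i → δ (f i) t) count≢0
... | i , i<n , δ≢0' = i , i<n , δ≢0 (f i) t δ≢0'

module Enumeration (c χ : ℕ → ℕ) (χ≤1 : ∀ t → χ t ≤ 1) (c-step : ∀ j → c j < c (suc j))
                   (χ-value : ∀ j → χ (c j) ≡ 1) (χ-onto : ∀ t → χ t ≡ 1 → ∃ λ j → c j ≡ t) where

  c-mono : ∀ {i j} → i < j → c i < c j
  c-mono {i} {suc j} i<1+j with m≤n⇒m<n∨m≡n (s≤s⁻¹ i<1+j)
  ... | inj₁ i<j  = <-trans (c-mono i<j) (c-step j)
  ... | inj₂ refl = c-step i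

  c-injective : ∀ {i j} → c i ≡ c j → i ≡ j
  c-injective {i} {j} ci≡cj with <-cmp i j
  ... | tri< i<j _ _ = ⊥-elim (<-irrefl ci≡cj (c-mono i<j))
  ... | tri≈ _ i≡j _ = i≡j
  ... | tri> _ _ j<i = ⊥-elim (<-irrefl (sym ci≡cj) (c-mono j<i))

  χ-01 : ∀ t → χ t ≡ 0 ⊎ χ t ≡ 1
  χ-01 t with χ t | χ≤1 t
  ... | zero     | _ = inj₁ refl
  ... | suc zero | _ = inj₂ refl
  ... | suc (suc _) | s≤s ()

  rank : ℕ → ℕ
  rank N = sumℕ N χ

  Below : ℕ → Set
  Below N = (∀ j → c j < N → j < rank N) × (∀ j → j < rank N → c j < N)

  index-of-value : ∀ N → Below N → χ N ≡ 1 → c (rank N) ≡ N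
  index-of-value N (index< , value<) χN≡1 = subst (λ j → c j ≡ N) m≡rank cm≡N
    where
    m = proj₁ (χ-onto N χN≡1)
    cm≡N = proj₂ (χ-onto N χN≡1)
    m≡rank : m ≡ rank N
    m≡rank with <-cmp m (rank N)
    ... | tri< m<r _ _ = ⊥-elim (<-irrefl cm≡N (value< m m<r))
    ... | tri≈ _ m≡r _ = m≡r
    ... | tri> _ _ r<m = ⊥-elim (<-irrefl refl (index< (rank N) (subst (c (rank N) <_) cm≡N (c-mono r<m))))

  below : ∀ N → Below N
  below zero = (λ _ ()) , (λ _ ())
  below (suc N) with below N | χ-01 N
  ... | index< , value< | inj₁ χN≡0 = index<′ , value<′
    where
    rank≡ : rank (suc N) ≡ rank N
    rank≡ = trans (cong (rank N +_) χN≡0) (+-identityʳ _)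
    index<′ : ∀ j → c j < suc N → j < rank (suc N)
    index<′ j cj<1+N with m≤n⇒m<n∨m≡n (s≤s⁻¹ cj<1+N)
    ... | inj₁ cj<N  = subst (j <_) (sym rank≡) (index< j cj<N)
    ... | inj₂ cj≡N = ⊥-elim (0≢1+n (trans (sym χN≡0) (trans (cong χ (sym cj≡N)) (χ-value j))))
    value<′ : ∀ j → j < rank (suc N) → c j < suc N
    value<′ j j<r = m≤n⇒m≤1+n (value< j (subst (j <_) rank≡ j<r))
  ... | index< , value< | inj₂ χN≡1 = index<′ , value<′
    where
    rank≡ : rank (suc N) ≡ suc (rank N)
    rank≡ = trans (cong (rank N +_) χN≡1) (+-comm (rank N) 1)
    c-rank : c (rank N) ≡ N
    c-rank = index-of-value N (index< , value<) χN≡1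
    index<′ : ∀ j → c j < suc N → j < rank (suc N)
    index<′ j cj<1+N with m≤n⇒m<n∨m≡n (s≤s⁻¹ cj<1+N)
    ... | inj₁ cj<N = subst (j <_) (sym rank≡) (m≤n⇒m≤1+n (index< j cj<N))
    ... | inj₂ cj≡N = subst (j <_) (sym rank≡) (s≤s (≤-reflexive (c-injective (trans cj≡N (sym c-rank)))))
    value<′ : ∀ j → j < rank (suc N) → c j < suc N
    value<′ j j<r with m≤n⇒m<n∨m≡n (s≤s⁻¹ (subst (j <_) rank≡ j<r))
    ... | inj₁ j<rank  = m≤n⇒m≤1+n (value< j j<rank)
    ... | inj₂ refl = s≤s (≤-reflexive c-rank)

  sum-below : ∀ N → sumℕ (rank N) c ≡ sumℕ N (λ t → χ t * t)
  sum-below zero = refl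
  sum-below (suc N) with χ-01 N
  ... | inj₁ χN≡0 = begin
    sumℕ (rank N + χ N) c                  ≡⟨ cong (λ k → sumℕ (rank N + k) c) χN≡0 ⟩
    sumℕ (rank N + 0) c                    ≡⟨ cong (λ k → sumℕ k c) (+-identityʳ (rank N)) ⟩
    sumℕ (rank N) c                        ≡⟨ sum-below N ⟩
    sumℕ N (λ t → χ t * t)                 ≡⟨ +-identityʳ _ ⟨
    sumℕ N (λ t → χ t * t) + 0 * N         ≡⟨ cong (λ k → sumℕ N (λ t → χ t * t) + k * N) χN≡0 ⟨
    sumℕ (suc N) (λ t → χ t * t)           ∎
    where open ≡-Reasoning
  ... | inj₂ χN≡1 = begin
    sumℕ (rank N + χ N) c                  ≡⟨ cong (λ k → sumℕ (rank N + k) c) χN≡1 ⟩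
    sumℕ (rank N + 1) c                    ≡⟨ cong (λ k → sumℕ k c) (+-comm (rank N) 1) ⟩
    sumℕ (rank N) c + c (rank N)           ≡⟨ cong₂ _+_ (sum-below N) (index-of-value N (below N) χN≡1) ⟩
    sumℕ N (λ t → χ t * t) + N             ≡⟨ cong (sumℕ N (λ t → χ t * t) +_) (*-identityˡ N) ⟨
    sumℕ N (λ t → χ t * t) + 1 * N         ≡⟨ cong (λ k → sumℕ N (λ t → χ t * t) + k * N) χN≡1 ⟨
    sumℕ (suc N) (λ t → χ t * t)           ∎
    where open ≡-Reasoning

pᵏ⁺¹-split : ∀ p k E → p ^ suc k * E ≡ p ^ k * E * p
pᵏ⁺¹-split p k E = trans (*-assoc p (p ^ k) E) (*-comm p (p ^ k * E))

digit-low : ∀ m L E k j → j < k → digit (suc m) (L + suc m ^ k * E) j ≡ digit (suc m) L j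
digit-low m L E (suc k) zero    _   = trans (cong (λ z → (L + z) % suc m) (pᵏ⁺¹-split (suc m) k E))
                                            ([m+kn]%n≡m%n L (suc m ^ k * E) (suc m))
digit-low m L E (suc k) (suc j) j<k = trans (cong (λ z → digit p z j) shifted) (digit-low m (L / p) E k j (s≤s⁻¹ j<k))
  where
  p = suc m
  shifted : (L + p ^ suc k * E) / p ≡ L / p + p ^ k * E
  shifted = trans (cong (λ z → (L + z) / p) (pᵏ⁺¹-split p k E))
                  (trans (+-distrib-/-∣ʳ L (divides-refl (p ^ k * E))) (cong (L / p +_) (m*n/n≡m (p ^ k * E) p)))

mod-mul : ∀ Q .{{_ : NonZero Q}} k x → (k * x) % Q ≡ (k * (x % Q)) % Q
mod-mul Q k x = trans (%-distribˡ-* k x Q) (trans (cong (λ r → ((k % Q) * r) % Q) (sym (m%n%n≡m%n x Q)))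
                                                  (sym (%-distribˡ-* k (x % Q) Q)))

-- Here p^a ≡ 1, and
-- multiplication by p acts on the a-digit base-p expansions of residues v < Q by
-- cyclic rotation: the top digit of v becomes the bottom digit of p·v mod Q.
module Rotation (m a₁ Q : ℕ) .{{_ : NonZero Q}} (pᵃ≡1+Q : suc m ^ suc a₁ ≡ suc Q) where

  p a : ℕ
  p = suc m
  a = suc a₁

  pᵃ-unit : ∀ Y → (p ^ a * Y) % Q ≡ Y % Q
  pᵃ-unit Y = begin
    (p ^ a * Y) % Q ≡⟨ cong (λ z → (z * Y) % Q) pᵃ≡1+Q ⟩
    (Y + Q * Y) % Q ≡⟨ cong (λ z → (Y + z) % Q) (*-comm Q Y) ⟩
    (Y + Y * Q) % Q ≡⟨ [m+kn]%n≡m%n Y Y Q ⟩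
    Y % Q           ∎
    where open ≡-Reasoning

  pⁱ-cancel : ∀ i x y → (p ^ i * x) % Q ≡ (p ^ i * y) % Q → x % Q ≡ y % Q
  pⁱ-cancel i x y pⁱx≡pⁱy = begin
    x % Q                               ≡⟨ unit-power i x ⟨
    ((p ^ a) ^ i * x) % Q               ≡⟨ cong (_% Q) (inverse-factor x) ⟩
    (k * (p ^ i * x)) % Q               ≡⟨ mod-mul Q k (p ^ i * x) ⟩
    (k * ((p ^ i * x) % Q)) % Q         ≡⟨ cong (λ r → (k * r) % Q) pⁱx≡pⁱy ⟩
    (k * ((p ^ i * y) % Q)) % Q         ≡⟨ mod-mul Q k (p ^ i * y) ⟨
    (k * (p ^ i * y)) % Q               ≡⟨ cong (_% Q) (inverse-factor y) ⟨
    ((p ^ a) ^ i * y) % Q               ≡⟨ unit-power i y ⟩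
    y % Q                               ∎
    where
    open ≡-Reasoning
    k = p ^ (a₁ * i)
    unit-power : ∀ n Y → ((p ^ a) ^ n * Y) % Q ≡ Y % Q
    unit-power zero    Y = cong (_% Q) (+-identityʳ Y)
    unit-power (suc n) Y = trans (cong (_% Q) (*-assoc (p ^ a) ((p ^ a) ^ n) Y)) (trans (pᵃ-unit _) (unit-power n Y))
    inverse-factor : ∀ z → (p ^ a) ^ i * z ≡ k * (p ^ i * z)
    inverse-factor z = trans (cong (_* z) kpⁱ) (*-assoc k (p ^ i) z)
      where
      kpⁱ : (p ^ a) ^ i ≡ k * p ^ i
      kpⁱ = trans (^-*-assoc p a i) (trans (cong (p ^_) (+-comm i (a₁ * i))) (^-distribˡ-+-* p (a₁ * i) i))

  rot : ℕ → ℕ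
  rot v = (p * v) % Q

  -- Division of p·v by Q: the quotient is the carry that wraps around.
  carry : ℕ → ℕ
  carry v = (p * v) / Q

  carry<p : ∀ {v} → v < Q → carry v < p
  carry<p v<Q = m<n*o⇒m/o<n (*-monoʳ-< p v<Q)

  division : ∀ v → p * v ≡ rot v + carry v * Q
  division v = m≡m%n+[m/n]*n (p * v) Q

  -- Since p^a = Q + 1, the carry reappears as the lowest digit of rot v.
  wrap-around : ∀ v → rot v + p ^ a₁ * carry v * p ≡ carry v + v * p
  wrap-around v = begin
    rot v + p ^ a₁ * E * p     ≡⟨ cong (rot v +_) (rearrange (p ^ a₁) E p) ⟩
    rot v + E * p ^ a          ≡⟨ cong (λ z → rot v + E * z) pᵃ≡1+Q ⟩
    rot v + E * suc Q          ≡⟨ expand (rot v) E Q ⟩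
    (rot v + E * Q) + E        ≡⟨ cong (_+ E) (division v) ⟨
    p * v + E                  ≡⟨ +-comm (p * v) E ⟩
    E + p * v                  ≡⟨ cong (E +_) (*-comm p v) ⟩
    E + v * p                  ∎
    where
    open ≡-Reasoning
    E = carry v
    rearrange : ∀ P E p → P * E * p ≡ E * (p * P)
    rearrange = solve-∀
    expand : ∀ r E Q → r + E * suc Q ≡ (r + E * Q) + E
    expand = solve-∀

  carry≡low-digit : ∀ {v} → v < Q → rot v % p ≡ carry v
  carry≡low-digit {v} v<Q = begin
    rot v % p                             ≡⟨ [m+kn]%n≡m%n (rot v) (p ^ a₁ * carry v) p ⟨
    (rot v + p ^ a₁ * carry v * p) % p    ≡⟨ cong (_% p) (wrap-around v) ⟩
    (carry v + v * p) % p                 ≡⟨ [m+kn]%n≡m%n (carry v) v p ⟩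
    carry v % p                           ≡⟨ m<n⇒m%n≡m (carry<p v<Q) ⟩
    carry v                               ∎
    where open ≡-Reasoning

  unrotate : ∀ {v} → v < Q → v ≡ rot v / p + p ^ a₁ * carry v
  unrotate {v} v<Q = sym (*-cancelʳ-≡ _ v p (+-cancelˡ-≡ E _ _ (begin
    E + (rot v / p + p ^ a₁ * E) * p     ≡⟨ cong (E +_) (*-distribʳ-+ p (rot v / p) (p ^ a₁ * E)) ⟩
    E + (rot v / p * p + p ^ a₁ * E * p) ≡⟨ +-assoc E _ _ ⟨
    E + rot v / p * p + p ^ a₁ * E * p   ≡⟨ cong (_+ p ^ a₁ * E * p) low-high ⟩
    rot v + p ^ a₁ * E * p               ≡⟨ wrap-around v ⟩
    E + v * p                            ∎)))
    where
    open ≡-Reasoning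
    E = carry v
    low-high : E + rot v / p * p ≡ rot v
    low-high = trans (cong (_+ rot v / p * p) (sym (carry≡low-digit v<Q))) (sym (m≡m%n+[m/n]*n (rot v) p))

  digit-rot : ∀ {v} j → v < Q → suc j < a → digit p v j ≡ digit p (rot v) (suc j)
  digit-rot {v} j v<Q j+1<a = trans (cong (λ z → digit p z j) (unrotate v<Q)) (digit-low m (rot v / p) (carry v) a₁ j (s≤s⁻¹ j+1<a))

  module Orbit (u : ℕ) (u<Q : u < Q) where

    w : ℕ → ℕ
    w i = (p ^ i * u) % Q

    w<Q : ∀ i → w i < Q
    w<Q i = m%n<n (p ^ i * u) Q

    u%Q≡u : u % Q ≡ u
    u%Q≡u = m<n⇒m%n≡m u<Q

    w-shift : ∀ i t → w (i + t) ≡ (p ^ i * w t) % Q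
    w-shift i t = trans (cong (λ z → (z * u) % Q) (^-distribˡ-+-* p i t))
                        (trans (cong (_% Q) (*-assoc (p ^ i) (p ^ t) u)) (mod-mul Q (p ^ i) (p ^ t * u)))

    w-suc : ∀ i → w (suc i) ≡ rot (w i)
    w-suc i = trans (cong (_% Q) (*-assoc p (p ^ i) u)) (mod-mul Q p (p ^ i * u))

    orbit-step : ∀ i → p * w i ≡ w (suc i) + Q * digit p (w (suc i)) 0
    orbit-step i = begin
      p * w i                             ≡⟨ division (w i) ⟩
      rot (w i) + carry (w i) * Q         ≡⟨ cong (rot (w i) +_) (*-comm (carry (w i)) Q) ⟩
      rot (w i) + Q * carry (w i)         ≡⟨ cong (λ r → rot (w i) + Q * r) (carry≡low-digit (w<Q i)) ⟨
      rot (w i) + Q * (rot (w i) % p)     ≡⟨ cong (λ r → r + Q * (r % p)) (w-suc i) ⟨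
      w (suc i) + Q * (w (suc i) % p)     ∎
      where open ≡-Reasoning

    digit-travel : ∀ i j → j < a → digit p (w i) 0 ≡ digit p (w (i + j)) j
    digit-travel i zero    _     = cong (λ k → digit p (w k) 0) (sym (+-identityʳ i))
    digit-travel i (suc j) j+1<a = begin
      digit p (w i) 0                   ≡⟨ digit-travel i j (<-trans (n<1+n j) j+1<a) ⟩
      digit p (w (i + j)) j             ≡⟨ digit-rot j (w<Q (i + j)) j+1<a ⟩
      digit p (rot (w (i + j))) (suc j) ≡⟨ cong (λ z → digit p z (suc j)) (w-suc (i + j)) ⟨
      digit p (w (suc (i + j))) (suc j) ≡⟨ cong (λ k → digit p (w k) (suc j)) (+-suc i j) ⟨
      digit p (w (i + suc j)) (suc j)   ∎
      where open ≡-Reasoning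

    return⇒period : ∀ i t → w (i + t) ≡ w i → w t ≡ u
    return⇒period i t returns = begin
      w t          ≡⟨ m<n⇒m%n≡m (w<Q t) ⟨
      w t % Q      ≡⟨ pⁱ-cancel i (w t) u (trans (sym (w-shift i t)) returns) ⟩
      u % Q        ≡⟨ u%Q≡u ⟩
      u            ∎
      where open ≡-Reasoning

    module Period (b : ℕ) (period : w b ≡ u) (minimal : ∀ t → 1 ≤ t → t < b → w t ≢ u) where

      b≤a : b ≤ a
      b≤a = ≮⇒≥ (λ a<b → minimal a (s≤s z≤n) a<b (trans (pᵃ-unit u) u%Q≡u))

      no-return : ∀ i j → i < j → j < b → w j ≢ w i
      no-return i j i<j j<b wj≡wi = minimal (j ∸ i) (m<n⇒0<n∸m i<j) (≤-<-trans (m∸n≤m j i) j<b)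
        (return⇒period i (j ∸ i) (trans (cong w (m+[n∸m]≡n (<⇒≤ i<j))) wj≡wi))

      orbit-injective : ∀ i j → i < b → j < b → w i ≡ w j → i ≡ j
      orbit-injective i j i<b j<b wi≡wj with <-cmp i j
      ... | tri≈ _ i≡j _ = i≡j
      ... | tri< i<j _ _ = ⊥-elim (no-return i j i<j j<b (sym wi≡wj))
      ... | tri> _ _ j<i = ⊥-elim (no-return j i j<i i<b wi≡wj)

      digit-via-orbit : ∀ j → j < b → digit p u j ≡ digit p (w (suc (b ∸ suc j))) 0
      digit-via-orbit j j<b = begin
        digit p u j                          ≡⟨ cong (λ z → digit p z j) period ⟨
        digit p (w b) j                      ≡⟨ cong (λ k → digit p (w k) j) back-to-b ⟨
        digit p (w (suc (b ∸ suc j) + j)) j  ≡⟨ digit-travel (suc (b ∸ suc j)) j (<-≤-trans j<b b≤a) ⟨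
        digit p (w (suc (b ∸ suc j))) 0      ∎
        where
        open ≡-Reasoning
        back-to-b : suc (b ∸ suc j) + j ≡ b
        back-to-b = trans (cong (_+ j) (sym (+-∸-assoc 1 j<b))) (m∸n+n≡m (<⇒≤ j<b))

      -- Summing p · w i = w (i+1) + Q · u_(b-1-i) over one period.
      orbit-sum : m * sumℕ b w ≡ Q * sumℕ b (digit p u)
      orbit-sum = +-cancelˡ-≡ S _ _ (begin
        p * S                                                          ≡⟨ sum-* b p w ⟨
        sumℕ b (λ i → p * w i)                                         ≡⟨ sum-ext b _ _ (λ i _ → orbit-step i) ⟩
        sumℕ b (λ i → w (suc i) + Q * low (suc i))                     ≡⟨ sum-+ b _ _ ⟩
        sumℕ b (λ i → w (suc i)) + sumℕ b (λ i → Q * low (suc i))      ≡⟨ cong₂ _+_ (sum-rotate b w (trans period (sym w-zero))) (sum-* b Q (λ i → low (suc i))) ⟩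
        S + Q * sumℕ b (λ i → low (suc i))                             ≡⟨ cong (λ s → S + Q * s) digits ⟩
        S + Q * sumℕ b (digit p u)                                     ∎)
        where
        open ≡-Reasoning
        S = sumℕ b w
        low : ℕ → ℕ
        low i = digit p (w i) 0
        w-zero : w 0 ≡ u
        w-zero = trans (cong (_% Q) (+-identityʳ u)) u%Q≡u
        digits : sumℕ b (λ i → low (suc i)) ≡ sumℕ b (digit p u)
        digits = trans (sym (sum-reverse b (λ i → low (suc i)))) (sym (sum-ext b _ _ digit-via-orbit))

-- The slope of H^∞ on [l, l+1], in the non-degenerate situation
-- p = 2+k, a = 1+a₁, q = 2+Q₁ (so Q = q-1 = 1+Q₁), d = 1+d₁, b = 1+b₁.
module Slope (k a₁ Q₁ d₁ b₁ u : ℕ) (pᵃ≡q : suc (suc k) ^ suc a₁ ≡ suc (suc Q₁)) (u<Q : u < suc Q₁)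
             (least : IsLeastPeriod (suc (suc k)) (suc (suc Q₁)) u (suc b₁))
             (x : ℕ → ℚ) (listing : IsOrderedListing (suc (suc k)) (suc (suc Q₁)) u (suc b₁) (suc d₁) x) where

  q Q d b : ℕ
  q = suc (suc Q₁)
  Q = suc Q₁
  d = suc d₁
  b = suc b₁

  open Rotation (suc k) a₁ Q pᵃ≡q
  open Orbit u u<Q

  members : ∀ j → InUnionM p q u b (x j)
  members = proj₁ listing

  exhaustive : ∀ v → InUnionM p q u b v → ∃ λ j → x j ≡ v
  exhaustive = proj₁ (proj₂ listing)

  x-injective : ∀ {i j} → x i ≡ x j → i ≡ j
  x-injective = proj₁ (proj₂ (proj₂ listing))

  deg-sorted : ∀ j → deg d (x j) ℚ.≤ deg d (x (suc j))
  deg-sorted = proj₂ (proj₂ (proj₂ listing))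

  ≡u-mod-Q⇔ : ∀ t → ModEq Q (ℤ.+ (p ^ t * u)) (ℤ.+ u) ⇔ (w t ≡ u)
  ≡u-mod-Q⇔ t = mk⇔ (λ ≡u → trans (Equivalence.to (modEq⇔%≡ Q (p ^ t * u) u) ≡u) u%Q≡u)
                    (λ wt≡u → Equivalence.from (modEq⇔%≡ Q (p ^ t * u) u) (trans wt≡u (sym u%Q≡u)))

  open Period b (Equivalence.to (≡u-mod-Q⇔ b) (proj₁ (proj₂ least)))
                (λ t 1≤t t<b wt≡u → proj₂ (proj₂ least) t 1≤t t<b (Equivalence.from (≡u-mod-Q⇔ t) wt≡u))

  c : ℕ → ℕ
  c j = proj₁ (proj₂ (members j))

  x≡c/Q : ∀ j → x j ≡ frac (c j) Q
  x≡c/Q j = proj₂ (proj₂ (proj₂ (proj₂ (members j))))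

  c-on-orbit : ∀ j → ∃ λ i → i < b × c j % Q ≡ w i
  c-on-orbit j with members j
  ... | i , cj , i<b , cj≡pⁱu , _ = i , i<b , Equivalence.to (modEq⇔%≡ Q cj (p ^ i * u)) cj≡pⁱu

  deg-x : ∀ j → deg d (x j) ≡ frac (c j) (Q * d)
  deg-x j = trans (cong (ℚ._* frac 1 d) (x≡c/Q j))
                  (trans (frac-* (c j) Q₁ 1 d₁) (cong (λ n → frac n (Q * d)) (*-identityʳ (c j))))

  -- The listing is sorted and repetition-free, so the numerators increase strictly.
  c-step : ∀ j → c j < c (suc j)
  c-step j = ≤∧≢⇒< c≤c′ c≢c′
    where
    c≤c′ : c j ≤ c (suc j)
    c≤c′ = frac-cancel-≤ (c j) (c (suc j)) (ℕ.pred (Q * d))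
             (subst₂ ℚ._≤_ (deg-x j) (deg-x (suc j)) (deg-sorted j))
    c≢c′ : c j ≢ c (suc j)
    c≢c′ cj≡cj′ = 1+n≢n (sym (x-injective
                    (trans (x≡c/Q j) (trans (cong (λ n → frac n Q) cj≡cj′) (sym (x≡c/Q (suc j)))))))

  -- χ t = 1 exactly when t is a numerator, i.e. t mod Q lies on the orbit.
  χ : ℕ → ℕ
  χ t = count b w (t % Q)

  χ≤1 : ∀ t → χ t ≤ 1
  χ≤1 t = count≤1 b w orbit-injective (t % Q)

  χ-value : ∀ j → χ (c j) ≡ 1
  χ-value j with c-on-orbit j
  ... | i , i<b , cj≡wi = ≤-antisym (χ≤1 (c j)) (subst (λ r → 1 ≤ count b w r) (sym cj≡wi) (count-hit b w i i<b))

  χ-onto : ∀ t → χ t ≡ 1 → ∃ λ j → c j ≡ t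
  χ-onto t χt≡1 with count-preimage b w (t % Q) (λ χt≡0 → 0≢1+n (trans (sym χt≡0) χt≡1))
  ... | i , i<b , wi≡t = j , frac-injective (c j) t Q₁ (trans (sym (x≡c/Q j)) xj≡t/Q)
    where
    t-member : InUnionM p q u b (frac t Q)
    t-member = i , t , i<b , Equivalence.from (modEq⇔%≡ Q t (p ^ i * u)) (sym wi≡t) , refl
    j = proj₁ (exhaustive (frac t Q) t-member)
    xj≡t/Q = proj₂ (exhaustive (frac t Q) t-member)

  open Enumeration c χ χ≤1 c-step χ-value χ-onto

  χ-periodic : ∀ n r → r < Q → χ (n * Q + r) ≡ count b w r
  χ-periodic n r r<Q = cong (count b w) (trans (cong (_% Q) (+-comm (n * Q) r))
                                              (trans ([m+kn]%n≡m%n r n Q) (m<n⇒m%n≡m r<Q)))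

  -- Every interval [nQ, (n+1)Q) contains exactly b numerators, nQ + w i for i < b.
  rank-period : ∀ n → rank (n * Q) ≡ b * n
  rank-period zero    = sym (*-zeroʳ b)
  rank-period (suc n) = begin
    rank (Q + n * Q)                            ≡⟨ cong rank (+-comm Q (n * Q)) ⟩
    rank (n * Q + Q)                            ≡⟨ sum-split (n * Q) Q χ ⟩
    rank (n * Q) + sumℕ Q (λ r → χ (n * Q + r)) ≡⟨ cong₂ _+_ (rank-period n) (sum-ext Q _ _ (χ-periodic n)) ⟩
    b * n + sumℕ Q (count b w)                  ≡⟨ cong (b * n +_) count-total ⟩
    b * n + b                                   ≡⟨ +-comm (b * n) b ⟩
    b + b * n                                   ≡⟨ *-suc b n ⟨
    b * suc n                                   ∎
    where
    open ≡-Reasoning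
    count-total : sumℕ Q (count b w) ≡ b
    count-total = trans (sum-ext Q _ _ (λ t _ → sym (*-identityʳ _)))
                  (trans (sum-by-count b Q w (λ _ → 1) (λ i _ → w<Q i)) (trans (sum-const b 1) (*-identityʳ b)))

  S : ℕ
  S = sumℕ b w

  numerators-in-period : ∀ n → sumℕ Q (λ r → χ (n * Q + r) * (n * Q + r)) ≡ b * (n * Q) + S
  numerators-in-period n = begin
    sumℕ Q (λ r → χ (n * Q + r) * (n * Q + r)) ≡⟨ sum-ext Q _ _ (λ r r<Q → cong (_* (n * Q + r)) (χ-periodic n r r<Q)) ⟩
    sumℕ Q (λ r → count b w r * (n * Q + r))   ≡⟨ sum-by-count b Q w (λ r → n * Q + r) (λ i _ → w<Q i) ⟩
    sumℕ b (λ i → n * Q + w i)                 ≡⟨ sum-+ b _ _ ⟩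
    sumℕ b (λ _ → n * Q) + S                   ≡⟨ cong (_+ S) (sum-const b (n * Q)) ⟩
    b * (n * Q) + S                            ∎
    where open ≡-Reasoning

  prefix-sum : ∀ n → sumℕ (b * n) c ≡ sumℕ (n * Q) (λ t → χ t * t)
  prefix-sum n = trans (cong (λ r → sumℕ r c) (sym (rank-period n))) (sum-below (n * Q))

  -- The l-th block of b consecutive numerators consists of lQ + w 0, …, lQ + w (b-1).
  block-sum : ∀ l → sumℕ b (λ j → c (b * l + j)) ≡ b * (l * Q) + S
  block-sum l = +-cancelˡ-≡ (sumℕ (b * l) c) _ _ (begin
    sumℕ (b * l) c + sumℕ b (λ j → c (b * l + j))       ≡⟨ sum-split (b * l) b c ⟨
    sumℕ (b * l + b) c                                  ≡⟨ cong (λ r → sumℕ r c) (trans (+-comm (b * l) b) (sym (*-suc b l))) ⟩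
    sumℕ (b * suc l) c                                  ≡⟨ prefix-sum (suc l) ⟩
    sumℕ (Q + l * Q) G                                  ≡⟨ cong (λ r → sumℕ r G) (+-comm Q (l * Q)) ⟩
    sumℕ (l * Q + Q) G                                  ≡⟨ sum-split (l * Q) Q G ⟩
    sumℕ (l * Q) G + sumℕ Q (λ r → G (l * Q + r))       ≡⟨ cong₂ _+_ (sym (prefix-sum l)) (numerators-in-period l) ⟩
    sumℕ (b * l) c + (b * (l * Q) + S)                  ∎)
    where
    open ≡-Reasoning
    G : ℕ → ℕ
    G t = χ t * t

  -- The final identity of fractions, using (p-1) S = Q · (u_0 + ⋯ + u_(b-1)).
  slope-arithmetic : ∀ l → (1 * (b * (l * Q) + S)) * (b * d * suc k * d)
                         ≡ (sumℕ b (digit p u) * d + l * (b * d * suc k)) * (b * (Q * d))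
  slope-arithmetic l = trans (expand-left b d (suc k) Q l S)
                        (trans (cong (λ z → b * l * Q * b * d * suc k * d + z * (b * d * d)) orbit-sum)
                               (expand-right b d (suc k) Q l (sumℕ b (digit p u))))
    where
    expand-left : ∀ b d m Q l S → (1 * (b * (l * Q) + S)) * (b * d * m * d) ≡ b * l * Q * b * d * m * d + (m * S) * (b * d * d)
    expand-left = solve-∀
    expand-right : ∀ b d m Q l D → b * l * Q * b * d * m * d + (Q * D) * (b * d * d) ≡ (D * d + l * (b * d * m)) * (b * (Q * d))
    expand-right = solve-∀

  slope-formula : ∀ l → slopeH b d x l ≡ frac (sumℕ b (digit p u)) (b * d * (p ∸ 1)) ℚ.+ frac l d
  slope-formula l = begin
    frac 1 b ℚ.* sumℚ b (λ j → deg d (x (b * l + j)))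
      ≡⟨ cong (frac 1 b ℚ.*_) (sumℚ-cong b _ _ (λ j → deg-x (b * l + j))) ⟩
    frac 1 b ℚ.* sumℚ b (λ j → frac (c (b * l + j)) (Q * d))
      ≡⟨ cong (frac 1 b ℚ.*_) (trans (sumℚ-frac b (ℕ.pred (Q * d)) (λ j → c (b * l + j))) (cong (λ n → frac n (Q * d)) (block-sum l))) ⟩
    frac 1 b ℚ.* frac (b * (l * Q) + S) (Q * d)
      ≡⟨ frac-* 1 b₁ (b * (l * Q) + S) (ℕ.pred (Q * d)) ⟩
    frac (1 * (b * (l * Q) + S)) (b * (Q * d))
      ≡⟨ frac-cross (1 * (b * (l * Q) + S)) (ℕ.pred (b * (Q * d))) (D * d + l * (b * d * suc k)) (ℕ.pred (b * d * suc k * d)) (slope-arithmetic l) ⟩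
    frac (D * d + l * (b * d * suc k)) (b * d * suc k * d)
      ≡⟨ frac-+ D (ℕ.pred (b * d * suc k)) l d₁ ⟨
    frac D (b * d * suc k) ℚ.+ frac l d ∎
    where
    open ≡-Reasoning
    D = sumℕ b (digit p u)

u<q-1 : ∀ {u q} → u + 2 ≤ q → u < q ∸ 1
u<q-1 {u} {q} u+2≤q = subst (_≤ q ∸ 1) (trans (+-∸-assoc u (s≤s z≤n)) (+-comm u 1)) (∸-monoˡ-≤ 1 u+2≤q)

mainTheorem6 : (p a q d u b : ℕ) → Prime p → 1 ≤ a → q ≡ p ^ a → 1 ≤ d → u + 2 ≤ q
    → IsLeastPeriod p q u b
    → (x : ℕ → ℚ) → IsOrderedListing p q u b d x
    → ∀ (l : ℕ) → slopeH b d x l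
      ≡ frac (sumℕ b (digit p u)) (b * d * (p ∸ 1)) +ℚ frac l d
-- The general case is Slope.slope-formula; every other case contradicts a hypothesis.
mainTheorem6 zero       _ _ _ _ _ p-prime = ⊥-elim (¬prime[0] p-prime)
mainTheorem6 (suc zero) _ _ _ _ _ p-prime = ⊥-elim (¬prime[1] p-prime)
mainTheorem6 (suc (suc k)) (suc a₁) (suc (suc Q₁)) (suc d₁) u (suc b₁) _ _ q≡pᵃ _ u+2≤q least x listing =
  Slope.slope-formula k a₁ Q₁ d₁ b₁ u (sym q≡pᵃ) (u<q-1 u+2≤q) least x listing
mainTheorem6 _ zero _ _ _ _ _ ()
mainTheorem6 _ _ _ zero _ _ _ _ _ ()
mainTheorem6 _ _ _ _ _ zero _ _ _ _ _ (() , _)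
mainTheorem6 _ _ zero       _ _ _ _ _ _ _ u+2≤q = ⊥-elim (n≮0 (u<q-1 u+2≤q))
mainTheorem6 _ _ (suc zero) _ _ _ _ _ _ _ u+2≤q = ⊥-elim (n≮0 (u<q-1 u+2≤q))
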